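{- If $n,m\ge 3$, then $\mathrm{mob}(P_n\,\square\, P_m)=3$.
   Context: $P_k$ is the path on $k$ vertices and $\square$ is the Cartesian product (so $P_n\,\square\,P_m$ is the $n\times m$ grid). A set $S\subseteq V(G)$ is a general position set if no three vertices of $S$ lie on a common shortest path. Robots are placed one per vertex of a general position set $S$; a move $u\to v$ along an edge $uv$ with $u\in S$ is legal if $v\notin S$ and $(S\setminus\{u\})\cup\{v\}$ is a general position set. $S$ is a mobile general position set if some sequence of legal moves starting from $S$ visits every vertex at least once; $\mathrm{mob}(G)$ is the maximum size of a mobile general position set. -}

module Defs where

open import Data.Nat using (ℕ; suc; _≤_)
open import Data.Fin using (Fin; toℕ)
open import Data.Product using (_×_; _,_; Σ; ∃)
open import Data.Sum using (_⊎_)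
open import Data.Empty using (⊥)
open import Data.List using (List; []; _∷_; _++_; length)
open import Data.List.Membership.Propositional using (_∈_; _∉_)
open import Data.List.Relation.Unary.Unique.Propositional using (Unique)
open import Relation.Binary.PropositionalEquality using (_≡_; _≢_)
open import Relation.Nullary using (¬_)

module GraphNotions {V : Set} (Adj : V → V → Set) where

  data Walk : V → V → Set where
    [] : ∀ {u} → Walk u u
    _∷_ : ∀ {u v w} → Adj u v → Walk v w → Walk u w

  len : ∀ {u v} → Walk u v → ℕ
  len [] = 0
  len (_ ∷ p) = suc (len p)

  data _∈w_ (x : V) : ∀ {u v} → Walk u v → Set where
    here  : ∀ {v} {p : Walk x v} → x ∈w p
    there : ∀ {u v w} {e : Adj u v} {p : Walk v w} → x ∈w p → x ∈w (e ∷ p)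

  IsShortest : ∀ {u v} → Walk u v → Set
  IsShortest {u} {v} p = (q : Walk u v) → len p ≤ len q

  GeneralPosition : List V → Set
  GeneralPosition S =
    ∀ {a b c} → a ∈ S → b ∈ S → c ∈ S → a ≢ b → b ≢ c → a ≢ c →
    ∀ {u v} (p : Walk u v) → IsShortest p →
    a ∈w p → b ∈w p → c ∈w p → ⊥

  data LegalMove : List V → List V → Set where
    move : ∀ xs ys {u v} → Adj u v → v ∉ (xs ++ u ∷ ys) →
           GeneralPosition (xs ++ v ∷ ys) →
           LegalMove (xs ++ u ∷ ys) (xs ++ v ∷ ys)

  data Run : List V → Set where
    stop : ∀ {S} → Run S
    step : ∀ {S T} → LegalMove S T → Run T → Run S

  Visits : V → ∀ {S} → Run S → Set
  Visits x {S} stop = x ∈ S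
  Visits x {S} (step _ r) = x ∈ S ⊎ Visits x r

  -- S (a set of vertices, as a duplicate-free list) is a mobile
  -- general position set
  Mobile : List V → Set
  Mobile S = Unique S × GeneralPosition S ×
             Σ (Run S) (λ r → ∀ x → Visits x r)

  MobIs : ℕ → Set
  MobIs k = (∃ λ S → Mobile S × length S ≡ k) ×
            (∀ S → Mobile S → length S ≤ k)

PathAdj : ∀ {n} → Fin n → Fin n → Set
PathAdj a b = suc (toℕ a) ≡ toℕ b ⊎ suc (toℕ b) ≡ toℕ a

GridAdj : (n m : ℕ) → Fin n × Fin m → Fin n × Fin m → Set
GridAdj n m (i , j) (i' , j') = (i ≡ i' × PathAdj j j') ⊎ (PathAdj i i' × j ≡ j')

mob-grid-is : (n m : ℕ) → ℕ → Set
mob-grid-is n m k = GraphNotions.MobIs (GridAdj n m) k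

-- In the grid the distance is the ℓ¹ distance of the coordinates, so a vertex lies on a
-- shortest x,z-path exactly when it lies in the box spanned by x and z; a set is in general
-- position iff none of its members lies in the box of two others.
--
-- Upper bound: a mobile set occupies the corner (0,0) at some moment.  If a general position
-- set contains the corner and three further vertices, no two of these are comparable in the
-- product order (the smaller one would lie in the box of the corner and the larger one), so
-- they are ordered along an antidiagonal and the middle one lies in the box of the other two.
--
-- Lower bound, on rows 0…N and columns 0…M: start with robots at (0,0), (0,M) and (1,1).  The
-- third robot sweeps rows 1…N between columns 1 and M−1; then the robots take turns to walk
-- down the right column, along the top row and up the left column.  In every configuration
-- used the three points are strictly monotone in one coordinate and the middle one is
-- extreme in the other, so none lies in the box of the other two.

module Submission where

open import Defs
open import Function using (_∘_; id)
open import Data.Nat using (ℕ; zero; suc; _+_; _∸_; _≤_; _<_; z≤n; s≤s; z<s; s<s; ∣_-_∣; _≤?_)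
open import Data.Nat.Properties
open import Algebra.Properties.CommutativeSemigroup +-commutativeSemigroup using (interchange)
open import Data.Fin using (Fin; zero; suc; toℕ)
open import Data.Fin.Properties using (toℕ≤pred[n])
open import Data.Product using (_×_; _,_; proj₁; proj₂; Σ-syntax; ∃-syntax)
import Data.Product as Product
open import Data.Sum using (_⊎_; inj₁; inj₂)
import Data.Sum as Sum
open import Data.Empty using (⊥; ⊥-elim)
open import Data.List using (List; []; _∷_; _++_; length)
open import Data.List.Properties using (length-++-sucʳ)
open import Data.List.Membership.Propositional using (_∈_; _∉_)
open import Data.List.Membership.Propositional.Properties using (∈-insert)
open import Data.List.Relation.Unary.Any using (here; there)
open import Data.List.Relation.Unary.All using (All; []; _∷_)
import Data.List.Relation.Unary.All as All
open import Data.List.Relation.Unary.All.Properties using (¬Any⇒All¬; All¬⇒¬Any; ++⁺; ++⁻ˡ; ++⁻ʳ)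
open import Data.List.Relation.Unary.AllPairs using ([]; _∷_)
open import Data.List.Relation.Unary.Unique.Propositional using (Unique)
open import Relation.Binary.Construct.Closure.ReflexiveTransitive using (Star; ε; _◅_; _◅◅_)
open import Relation.Binary.PropositionalEquality
open import Relation.Nullary using (¬_; yes; no)

Between₁ : ℕ → ℕ → ℕ → Set
Between₁ a b c = (a ≤ b × b ≤ c) ⊎ (c ≤ b × b ≤ a)

Between₁-sym : ∀ {a b c} → Between₁ a b c → Between₁ c b a
Between₁-sym = Sum.swap

Between₁-reflˡ : ∀ a c → Between₁ a a c
Between₁-reflˡ a c with ≤-total a c
... | inj₁ a≤c = inj₁ (≤-refl , a≤c)
... | inj₂ c≤a = inj₂ (c≤a , ≤-refl)

Between₁-reflʳ : ∀ a c → Between₁ a c c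
Between₁-reflʳ a c = Between₁-sym (Between₁-reflˡ c a)

¬Between₁-above : ∀ {a b c} → a < b → c < b → ¬ Between₁ a b c
¬Between₁-above a<b c<b (inj₁ (_ , b≤c)) = <⇒≱ c<b b≤c
¬Between₁-above a<b c<b (inj₂ (_ , b≤a)) = <⇒≱ a<b b≤a

¬Between₁-below : ∀ {a b c} → b < a → b < c → ¬ Between₁ a b c
¬Between₁-below b<a b<c (inj₁ (a≤b , _)) = <⇒≱ b<a a≤b
¬Between₁-below b<a b<c (inj₂ (c≤b , _)) = <⇒≱ b<c c≤b

∣-∣-additive-≤ : ∀ {a b c} → a ≤ b → b ≤ c → ∣ a - b ∣ + ∣ b - c ∣ ≡ ∣ a - c ∣
∣-∣-additive-≤ {a} {b} {c} a≤b b≤c = begin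
  ∣ a - b ∣ + ∣ b - c ∣  ≡⟨ cong₂ _+_ (m≤n⇒∣m-n∣≡n∸m a≤b) (m≤n⇒∣m-n∣≡n∸m b≤c) ⟩
  (b ∸ a) + (c ∸ b)      ≡⟨ +-comm (b ∸ a) (c ∸ b) ⟩
  (c ∸ b) + (b ∸ a)      ≡⟨ +-∸-assoc (c ∸ b) a≤b ⟨
  (c ∸ b) + b ∸ a        ≡⟨ cong (_∸ a) (m∸n+n≡m b≤c) ⟩
  c ∸ a                  ≡⟨ m≤n⇒∣m-n∣≡n∸m (≤-trans a≤b b≤c) ⟨
  ∣ a - c ∣              ∎
  where open ≡-Reasoning

Between₁⇒∣-∣-additive : ∀ {a b c} → Between₁ a b c → ∣ a - b ∣ + ∣ b - c ∣ ≡ ∣ a - c ∣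
Between₁⇒∣-∣-additive (inj₁ (a≤b , b≤c)) = ∣-∣-additive-≤ a≤b b≤c
Between₁⇒∣-∣-additive {a} {b} {c} (inj₂ (c≤b , b≤a)) = begin
  ∣ a - b ∣ + ∣ b - c ∣  ≡⟨ +-comm ∣ a - b ∣ ∣ b - c ∣ ⟩
  ∣ b - c ∣ + ∣ a - b ∣  ≡⟨ cong₂ _+_ (∣-∣-comm b c) (∣-∣-comm a b) ⟩
  ∣ c - b ∣ + ∣ b - a ∣  ≡⟨ ∣-∣-additive-≤ c≤b b≤a ⟩
  ∣ c - a ∣              ≡⟨ ∣-∣-comm c a ⟩
  ∣ a - c ∣              ∎
  where open ≡-Reasoning

∣-∣-additive⇒Between₁ : ∀ a b c → ∣ a - b ∣ + ∣ b - c ∣ ≤ ∣ a - c ∣ → Between₁ a b c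
∣-∣-additive⇒Between₁ zero b c h = inj₁ (z≤n , ≤-trans (m≤m+n b ∣ b - c ∣) h)
∣-∣-additive⇒Between₁ (suc a) zero zero h = inj₂ (z≤n , z≤n)
∣-∣-additive⇒Between₁ (suc a) zero (suc c) h = ⊥-elim (<⇒≱ ∣a-c∣<a+c h)
  where
  ∣a-c∣<a+c : ∣ a - c ∣ < suc a + suc c
  ∣a-c∣<a+c = s≤s (≤-trans (≤-trans (∣m-n∣≤m⊔n a c) (m⊔n≤m+n a c)) (+-monoʳ-≤ a (n≤1+n c)))
∣-∣-additive⇒Between₁ (suc a) (suc b) zero h = inj₂ (z≤n , ≤-trans (m≤n+m (suc b) ∣ a - b ∣) h)
∣-∣-additive⇒Between₁ (suc a) (suc b) (suc c) h =
  Sum.map (Product.map s≤s s≤s) (Product.map s≤s s≤s) (∣-∣-additive⇒Between₁ a b c h)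

∣n-1+n∣≡1 : ∀ n → ∣ n - suc n ∣ ≡ 1
∣n-1+n∣≡1 zero = refl
∣n-1+n∣≡1 (suc n) = ∣n-1+n∣≡1 n

∣-∣-step : ∀ {a b} t → suc a ≡ b ⊎ suc b ≡ a → ∣ a - t ∣ ≤ suc ∣ b - t ∣
∣-∣-step {a} {b} t a~b = ≤-trans (∣-∣-triangle a b t) (+-monoˡ-≤ ∣ b - t ∣ (≤-reflexive (unit a~b)))
  where
  unit : ∀ {a b} → suc a ≡ b ⊎ suc b ≡ a → ∣ a - b ∣ ≡ 1
  unit {a} (inj₁ refl) = ∣n-1+n∣≡1 a
  unit {b = b} (inj₂ refl) = trans (∣-∣-comm (suc b) b) (∣n-1+n∣≡1 b)

manhattan : ℕ × ℕ → ℕ × ℕ → ℕ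
manhattan (a , b) (c , d) = ∣ a - c ∣ + ∣ b - d ∣

Between₂ : ℕ × ℕ → ℕ × ℕ → ℕ × ℕ → Set
Between₂ (a , b) (c , d) (e , f) = Between₁ a c e × Between₁ b d f

Collinear₂ : ℕ × ℕ → ℕ × ℕ → ℕ × ℕ → Set
Collinear₂ p q r = Between₂ q p r ⊎ Between₂ p q r ⊎ Between₂ p r q

manhattan-self : ∀ p → manhattan p p ≡ 0
manhattan-self (a , b) = cong₂ _+_ (∣n-n∣≡0 a) (∣n-n∣≡0 b)

manhattan-triangle : ∀ p q r → manhattan p r ≤ manhattan p q + manhattan q r
manhattan-triangle (a , b) (c , d) (e , f) = begin
  ∣ a - e ∣ + ∣ b - f ∣                              ≤⟨ +-mono-≤ (∣-∣-triangle a c e) (∣-∣-triangle b d f) ⟩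
  (∣ a - c ∣ + ∣ c - e ∣) + (∣ b - d ∣ + ∣ d - f ∣)  ≡⟨ interchange ∣ a - c ∣ ∣ c - e ∣ ∣ b - d ∣ ∣ d - f ∣ ⟩
  (∣ a - c ∣ + ∣ b - d ∣) + (∣ c - e ∣ + ∣ d - f ∣)  ∎
  where open ≤-Reasoning

Between₂⇒manhattan-additive : ∀ {p q r} → Between₂ p q r → manhattan p q + manhattan q r ≡ manhattan p r
Between₂⇒manhattan-additive {a , b} {c , d} {e , f} (ace , bdf) = begin
  (∣ a - c ∣ + ∣ b - d ∣) + (∣ c - e ∣ + ∣ d - f ∣)  ≡⟨ interchange ∣ a - c ∣ ∣ b - d ∣ ∣ c - e ∣ ∣ d - f ∣ ⟩
  (∣ a - c ∣ + ∣ c - e ∣) + (∣ b - d ∣ + ∣ d - f ∣)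
    ≡⟨ cong₂ _+_ (Between₁⇒∣-∣-additive ace) (Between₁⇒∣-∣-additive bdf) ⟩
  ∣ a - e ∣ + ∣ b - f ∣                              ∎
  where open ≡-Reasoning

manhattan-additive⇒Between₂ : ∀ p q r → manhattan p q + manhattan q r ≤ manhattan p r → Between₂ p q r
manhattan-additive⇒Between₂ (a , b) (c , d) (e , f) h =
  ∣-∣-additive⇒Between₁ a c e rows , ∣-∣-additive⇒Between₁ b d f cols
  where
  split : (∣ a - c ∣ + ∣ c - e ∣) + (∣ b - d ∣ + ∣ d - f ∣) ≤ ∣ a - e ∣ + ∣ b - f ∣
  split = ≤-trans (≤-reflexive (interchange ∣ a - c ∣ ∣ c - e ∣ ∣ b - d ∣ ∣ d - f ∣)) h
  rows : ∣ a - c ∣ + ∣ c - e ∣ ≤ ∣ a - e ∣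
  rows = +-cancelʳ-≤ _ _ _ (≤-trans split (+-monoʳ-≤ ∣ a - e ∣ (∣-∣-triangle b d f)))
  cols : ∣ b - d ∣ + ∣ d - f ∣ ≤ ∣ b - f ∣
  cols = +-cancelˡ-≤ _ _ _ (≤-trans split (+-monoˡ-≤ ∣ b - f ∣ (∣-∣-triangle a c e)))

Between₂-sym : ∀ {p q r} → Between₂ p q r → Between₂ r q p
Between₂-sym {_ , _} {_ , _} {_ , _} = Product.map Between₁-sym Between₁-sym

Between₂-reflˡ : ∀ p r → Between₂ p p r
Between₂-reflˡ (a , b) (e , f) = Between₁-reflˡ a e , Between₁-reflˡ b f

Between₂-reflʳ : ∀ p r → Between₂ p r r
Between₂-reflʳ (a , b) (e , f) = Between₁-reflʳ a e , Between₁-reflʳ b f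

Collinear₂-swap₁₂ : ∀ {p q r} → Collinear₂ p q r → Collinear₂ q p r
Collinear₂-swap₁₂ (inj₁ qpr) = inj₂ (inj₁ qpr)
Collinear₂-swap₁₂ (inj₂ (inj₁ pqr)) = inj₁ pqr
Collinear₂-swap₁₂ (inj₂ (inj₂ prq)) = inj₂ (inj₂ (Between₂-sym prq))

Collinear₂-swap₂₃ : ∀ {p q r} → Collinear₂ p q r → Collinear₂ p r q
Collinear₂-swap₂₃ (inj₁ qpr) = inj₁ (Between₂-sym qpr)
Collinear₂-swap₂₃ (inj₂ (inj₁ pqr)) = inj₂ (inj₂ pqr)
Collinear₂-swap₂₃ (inj₂ (inj₂ prq)) = inj₂ (inj₁ prq)

Collinear₂-transpose : ∀ {a₁ a₂ a₃ b₁ b₂ b₃} →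
  Collinear₂ (a₁ , b₁) (a₂ , b₂) (a₃ , b₃) → Collinear₂ (b₁ , a₁) (b₂ , a₂) (b₃ , a₃)
Collinear₂-transpose = Sum.map Product.swap (Sum.map Product.swap Product.swap)

¬Collinear₂-rows : ∀ {a₁ a₂ a₃ b₁ b₂ b₃} → a₁ < a₂ → a₂ < a₃ → ¬ Between₁ b₁ b₂ b₃ →
                   ¬ Collinear₂ (a₁ , b₁) (a₂ , b₂) (a₃ , b₃)
¬Collinear₂-rows a₁<a₂ a₂<a₃ _ (inj₁ (rows , _)) = ¬Between₁-below a₁<a₂ (<-trans a₁<a₂ a₂<a₃) rows
¬Collinear₂-rows _ _ ¬cols (inj₂ (inj₁ (_ , cols))) = ¬cols cols
¬Collinear₂-rows a₁<a₂ a₂<a₃ _ (inj₂ (inj₂ (rows , _))) = ¬Between₁-above (<-trans a₁<a₂ a₂<a₃) a₂<a₃ rows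

¬Collinear₂-cols : ∀ {a₁ a₂ a₃ b₁ b₂ b₃} → a₁ < a₂ → a₂ < a₃ → ¬ Between₁ b₁ b₂ b₃ →
                   ¬ Collinear₂ (b₁ , a₁) (b₂ , a₂) (b₃ , a₃)
¬Collinear₂-cols a₁<a₂ a₂<a₃ ¬rows = ¬Collinear₂-rows a₁<a₂ a₂<a₃ ¬rows ∘ Collinear₂-transpose

module _ {A : Set} where

  Unique-replace : ∀ xs {ys} {u v : A} → Unique (xs ++ u ∷ ys) → v ∉ xs ++ u ∷ ys → Unique (xs ++ v ∷ ys)
  Unique-replace [] (_ ∷ uniq) v∉ = ¬Any⇒All¬ _ (v∉ ∘ there) ∷ uniq
  Unique-replace (x ∷ xs) (x∉ ∷ uniq) v∉ =
    ++⁺ (++⁻ˡ xs x∉) (≢-sym (v∉ ∘ here) ∷ All.tail (++⁻ʳ xs x∉)) ∷ Unique-replace xs uniq (v∉ ∘ there)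

  Unique⇒∉-replace : ∀ xs {ys} {u v : A} → Unique (xs ++ v ∷ ys) → v ≢ u → v ∉ xs ++ u ∷ ys
  Unique⇒∉-replace [] _ v≢u (here v≡u) = v≢u v≡u
  Unique⇒∉-replace [] (v∉ys ∷ _) _ (there v∈ys) = All¬⇒¬Any v∉ys v∈ys
  Unique⇒∉-replace (x ∷ xs) (x∉ ∷ _) _ (here refl) = All.lookup x∉ (∈-insert xs) refl
  Unique⇒∉-replace (x ∷ xs) (_ ∷ uniq) v≢u (there v∈) = Unique⇒∉-replace xs uniq v≢u v∈

  length-replace : ∀ xs {ys} {u v : A} → length (xs ++ u ∷ ys) ≡ length (xs ++ v ∷ ys)
  length-replace xs {ys} {u} {v} = trans (length-++-sucʳ xs u ys) (sym (length-++-sucʳ xs v ys))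

  companions : ∀ {S : List A} {c} → Unique S → 4 ≤ length S → c ∈ S →
               ∃[ x ] ∃[ y ] ∃[ z ] Unique (c ∷ x ∷ y ∷ z ∷ []) × All (_∈ S) (x ∷ y ∷ z ∷ [])
  companions {_ ∷ []} _ (s≤s ()) _
  companions {_ ∷ _ ∷ []} _ (s≤s (s≤s ())) _
  companions {_ ∷ _ ∷ _ ∷ []} _ (s≤s (s≤s (s≤s ()))) _
  companions {a ∷ b ∷ d ∷ e ∷ rest} {c}
    ((a≢b ∷ a≢d ∷ a≢e ∷ a∉) ∷ (b≢d ∷ b≢e ∷ b∉) ∷ (d≢e ∷ d∉) ∷ _) _ c∈ with c∈
  ... | here refl =
    b , d , e , (a≢b ∷ a≢d ∷ a≢e ∷ []) ∷ (b≢d ∷ b≢e ∷ []) ∷ (d≢e ∷ []) ∷ [] ∷ [] ,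
    there (here refl) ∷ there (there (here refl)) ∷ there (there (there (here refl))) ∷ []
  ... | there (here refl) =
    a , d , e , (≢-sym a≢b ∷ b≢d ∷ b≢e ∷ []) ∷ (a≢d ∷ a≢e ∷ []) ∷ (d≢e ∷ []) ∷ [] ∷ [] ,
    here refl ∷ there (there (here refl)) ∷ there (there (there (here refl))) ∷ []
  ... | there (there (here refl)) =
    a , b , e , (≢-sym a≢d ∷ ≢-sym b≢d ∷ d≢e ∷ []) ∷ (a≢b ∷ a≢e ∷ []) ∷ (b≢e ∷ []) ∷ [] ∷ [] ,
    here refl ∷ there (here refl) ∷ there (there (there (here refl))) ∷ []
  ... | there (there (there (here refl))) =
    a , b , d , (≢-sym a≢e ∷ ≢-sym b≢e ∷ ≢-sym d≢e ∷ []) ∷ (a≢b ∷ a≢d ∷ []) ∷ (b≢d ∷ []) ∷ [] ∷ [] ,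
    here refl ∷ there (here refl) ∷ there (there (here refl)) ∷ []
  ... | there (there (there (there c∈rest))) =
    a , b , d , (c≢ a∉ ∷ c≢ b∉ ∷ c≢ d∉ ∷ []) ∷ (a≢b ∷ a≢d ∷ []) ∷ (b≢d ∷ []) ∷ [] ∷ [] ,
    here refl ∷ there (here refl) ∷ there (there (here refl)) ∷ []
    where
    c≢ : ∀ {x} → All (x ≢_) rest → c ≢ x
    c≢ x∉ = ≢-sym (All.lookup x∉ c∈rest)

module WalkProperties {V : Set} (Adj : V → V → Set) where
  open GraphNotions Adj

  infixr 5 _++ʷ_
  _++ʷ_ : ∀ {u v w} → Walk u v → Walk v w → Walk u w
  [] ++ʷ q = q
  (e ∷ p) ++ʷ q = e ∷ (p ++ʷ q)

  len-++ʷ : ∀ {u v w} (p : Walk u v) (q : Walk v w) → len (p ++ʷ q) ≡ len p + len q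
  len-++ʷ [] q = refl
  len-++ʷ (e ∷ p) q = cong suc (len-++ʷ p q)

  ∈w-++ʷʳ : ∀ {x u v w} (p : Walk u v) {q : Walk v w} → x ∈w q → x ∈w (p ++ʷ q)
  ∈w-++ʷʳ [] x∈q = x∈q
  ∈w-++ʷʳ (e ∷ p) x∈q = there (∈w-++ʷʳ p x∈q)

  end-∈w : ∀ {u v} (p : Walk u v) → v ∈w p
  end-∈w [] = here
  end-∈w (e ∷ p) = there (end-∈w p)

module _ {V W : Set} {A : V → V → Set} {B : W → W → Set} where
  private
    module From = GraphNotions A
    module To = GraphNotions B

  mapWalk : (f : V → W) → (∀ {u v} → A u v → B (f u) (f v)) → ∀ {u v} → From.Walk u v → To.Walk (f u) (f v)
  mapWalk f f-adj From.[] = To.[]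
  mapWalk f f-adj (e From.∷ p) = f-adj e To.∷ mapWalk f f-adj p

  len-mapWalk : ∀ f (f-adj : ∀ {u v} → A u v → B (f u) (f v)) {u v} (p : From.Walk u v) →
                To.len (mapWalk f f-adj p) ≡ From.len p
  len-mapWalk f f-adj From.[] = refl
  len-mapWalk f f-adj (e From.∷ p) = cong suc (len-mapWalk f f-adj p)

module Moves {V : Set} (Adj : V → V → Set) where
  open GraphNotions Adj

  IsGPSet : List V → Set
  IsGPSet S = Unique S × GeneralPosition S

  move-IsGPSet : ∀ {S T} → LegalMove S T → Unique S → IsGPSet T
  move-IsGPSet (move xs _ _ v∉ gp) uniq = Unique-replace xs uniq v∉ , gp

  move-length : ∀ {S T} → LegalMove S T → length S ≡ length T
  move-length (move xs _ _ _ _) = length-replace xs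

  occupied-invariant : (P : List V → Set) → (∀ {S T} → LegalMove S T → P S → P T) →
                       ∀ {S x} → P S → (r : Run S) → Visits x r → ∃[ T ] P T × x ∈ T
  occupied-invariant P preserved PS stop x∈S = _ , PS , x∈S
  occupied-invariant P preserved PS (step _ r) (inj₁ x∈S) = _ , PS , x∈S
  occupied-invariant P preserved PS (step m r) (inj₂ visited) =
    occupied-invariant P preserved (preserved m PS) r visited

  infix 4 _↝_
  _↝_ : List V → List V → Set
  _↝_ = Star LegalMove

  toRun : ∀ {S T} → S ↝ T → Run S
  toRun ε = stop
  toRun (m ◅ t) = step m (toRun t)

  visits-start : ∀ {x S T} (t : S ↝ T) → x ∈ S → Visits x (toRun t)
  visits-start ε x∈S = x∈S
  visits-start (m ◅ t) x∈S = inj₁ x∈S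

  visits-◅◅ˡ : ∀ {x S T U} (t : S ↝ T) {u : T ↝ U} → Visits x (toRun t) → Visits x (toRun (t ◅◅ u))
  visits-◅◅ˡ ε {u} x∈S = visits-start u x∈S
  visits-◅◅ˡ (m ◅ t) (inj₁ x∈S) = inj₁ x∈S
  visits-◅◅ˡ (m ◅ t) (inj₂ visited) = inj₂ (visits-◅◅ˡ t visited)

  visits-◅◅ʳ : ∀ {x S T U} (t : S ↝ T) {u : T ↝ U} → Visits x (toRun u) → Visits x (toRun (t ◅◅ u))
  visits-◅◅ʳ ε visited = visited
  visits-◅◅ʳ (m ◅ t) visited = inj₂ (visits-◅◅ʳ t visited)

  module Lanes (Adj-sym : ∀ {u v} → Adj u v → Adj v u) (Adj-irrefl : ∀ {u v} → Adj u v → u ≢ v) where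

    advance : ∀ xs ys {u v} → Adj u v → IsGPSet (xs ++ v ∷ ys) → LegalMove (xs ++ u ∷ ys) (xs ++ v ∷ ys)
    advance xs ys u~v (uniq , gp) = move xs ys u~v (Unique⇒∉-replace xs uniq (≢-sym (Adj-irrefl u~v))) gp

    record Lane (xs ys : List V) (f : ℕ → V) (L : ℕ) : Set where
      field
        adjacent : ∀ {k} → k < L → Adj (f k) (f (suc k))
        gpset : ∀ {k} → k ≤ L → IsGPSet (xs ++ f k ∷ ys)

    Lane-tail : ∀ {xs ys f L} → Lane xs ys f (suc L) → Lane xs ys (f ∘ suc) L
    Lane-tail lane = record { adjacent = λ k<L → adjacent (s≤s k<L) ; gpset = λ k≤L → gpset (s≤s k≤L) }
      where open Lane lane

    slide : ∀ {xs ys f L} → Lane xs ys f L → xs ++ f 0 ∷ ys ↝ xs ++ f L ∷ ys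
    slide {L = zero} _ = ε
    slide {xs} {ys} {L = suc L} lane =
      advance xs ys (Lane.adjacent lane z<s) (Lane.gpset lane z<s) ◅ slide (Lane-tail lane)

    slideBack : ∀ {xs ys f L} → Lane xs ys f L → xs ++ f L ∷ ys ↝ xs ++ f 0 ∷ ys
    slideBack {L = zero} _ = ε
    slideBack {xs} {ys} {L = suc L} lane =
      slideBack (Lane-tail lane) ◅◅
      advance xs ys (Adj-sym (Lane.adjacent lane z<s)) (Lane.gpset lane z≤n) ◅ ε

    slide-visits : ∀ {xs ys f L k} (lane : Lane xs ys f L) → k ≤ L → Visits (f k) (toRun (slide lane))
    slide-visits {xs} lane z≤n = visits-start (slide lane) (∈-insert xs)
    slide-visits lane (s≤s k≤L) = inj₂ (slide-visits (Lane-tail lane) k≤L)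

    slideBack-visits : ∀ {xs ys f L k} (lane : Lane xs ys f L) → k ≤ L →
                       Visits (f k) (toRun (slideBack lane))
    slideBack-visits {xs} {L = zero} _ z≤n = ∈-insert xs
    slideBack-visits {xs} {L = suc L} lane z≤n =
      visits-◅◅ʳ (slideBack (Lane-tail lane)) (inj₂ (∈-insert xs))
    slideBack-visits lane (s≤s k≤L) =
      visits-◅◅ˡ (slideBack (Lane-tail lane)) (slideBack-visits (Lane-tail lane) k≤L)

module PathGraph {k : ℕ} = GraphNotions (PathAdj {k})
module PathWalks {k : ℕ} = WalkProperties (PathAdj {k})

module _ where
  open PathGraph
  open PathWalks

  shift : ∀ {k} {a b : Fin k} → Walk a b → Walk {suc k} (suc a) (suc b)
  shift = mapWalk suc (Sum.map (cong suc) (cong suc))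

  pathGeodesic : ∀ {k} (a b : Fin k) → Walk a b
  pathGeodesic zero zero = []
  pathGeodesic zero (suc zero) = inj₁ refl ∷ []
  pathGeodesic zero (suc (suc b)) = inj₁ refl ∷ shift (pathGeodesic zero (suc b))
  pathGeodesic (suc a) (suc b) = shift (pathGeodesic a b)
  pathGeodesic (suc zero) zero = inj₂ refl ∷ []
  pathGeodesic (suc (suc a)) zero = shift (pathGeodesic (suc a) zero) ++ʷ inj₂ refl ∷ []

  len-pathGeodesic : ∀ {k} (a b : Fin k) → len (pathGeodesic a b) ≡ ∣ toℕ a - toℕ b ∣
  len-pathGeodesic zero zero = refl
  len-pathGeodesic zero (suc zero) = refl
  len-pathGeodesic zero (suc (suc b)) =
    cong suc (trans (len-mapWalk _ _ (pathGeodesic zero (suc b))) (len-pathGeodesic zero (suc b)))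
  len-pathGeodesic (suc a) (suc b) = trans (len-mapWalk _ _ (pathGeodesic a b)) (len-pathGeodesic a b)
  len-pathGeodesic (suc zero) zero = refl
  len-pathGeodesic (suc (suc a)) zero = begin
    len (p ++ʷ inj₂ refl ∷ [])  ≡⟨ len-++ʷ p _ ⟩
    len p + 1                   ≡⟨ +-comm (len p) 1 ⟩
    suc (len p)                 ≡⟨ cong suc (len-mapWalk _ _ q) ⟩
    suc (len q)                 ≡⟨ cong suc (len-pathGeodesic (suc a) zero) ⟩
    suc (suc (toℕ a))           ∎
    where
    open ≡-Reasoning
    q = pathGeodesic (suc a) zero
    p = shift q

module Grid (n m : ℕ) where
  V : Set
  V = Fin n × Fin m

  open GraphNotions (GridAdj n m) public
  open WalkProperties (GridAdj n m) public
  open Moves (GridAdj n m) public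

  row col : V → ℕ
  row x = toℕ (proj₁ x)
  col x = toℕ (proj₂ x)

  coords : V → ℕ × ℕ
  coords x = row x , col x

  dist : V → V → ℕ
  dist x y = manhattan (coords x) (coords y)

  Between Collinear : V → V → V → Set
  Between x y z = Between₂ (coords x) (coords y) (coords z)
  Collinear x y z = Collinear₂ (coords x) (coords y) (coords z)

  Adj-sym : ∀ {u v} → GridAdj n m u v → GridAdj n m v u
  Adj-sym (inj₁ (refl , j~j′)) = inj₁ (refl , Sum.swap j~j′)
  Adj-sym (inj₂ (i~i′ , refl)) = inj₂ (Sum.swap i~i′ , refl)

  Adj-irrefl : ∀ {u v} → GridAdj n m u v → u ≢ v
  Adj-irrefl (inj₁ (_ , j~j)) refl = Sum.[ 1+n≢n , 1+n≢n ] j~j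
  Adj-irrefl (inj₂ (i~i , _)) refl = Sum.[ 1+n≢n , 1+n≢n ] i~i

  vertical : ∀ j {i i′} → PathGraph.Walk i i′ → Walk (i , j) (i′ , j)
  vertical j = mapWalk (_, j) (λ i~i′ → inj₂ (i~i′ , refl))

  horizontal : ∀ i {j j′} → PathGraph.Walk j j′ → Walk (i , j) (i , j′)
  horizontal i = mapWalk (i ,_) (λ j~j′ → inj₁ (refl , j~j′))

  geodesic : ∀ u v → Walk u v
  geodesic (i , j) (i′ , j′) = vertical j (pathGeodesic i i′) ++ʷ horizontal i′ (pathGeodesic j j′)

  len-geodesic : ∀ u v → len (geodesic u v) ≡ dist u v
  len-geodesic (i , j) (i′ , j′) = begin
    len (vertical j rows ++ʷ horizontal i′ cols)      ≡⟨ len-++ʷ (vertical j rows) (horizontal i′ cols) ⟩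
    len (vertical j rows) + len (horizontal i′ cols)  ≡⟨ cong₂ _+_ (len-mapWalk _ _ rows) (len-mapWalk _ _ cols) ⟩
    PathGraph.len rows + PathGraph.len cols
      ≡⟨ cong₂ _+_ (len-pathGeodesic i i′) (len-pathGeodesic j j′) ⟩
    ∣ toℕ i - toℕ i′ ∣ + ∣ toℕ j - toℕ j′ ∣            ∎
    where
    open ≡-Reasoning
    rows = pathGeodesic i i′
    cols = pathGeodesic j j′

  dist-step : ∀ {u w} t → GridAdj n m u w → dist u t ≤ suc (dist w t)
  dist-step {i , _} t (inj₁ (refl , j~j′)) =
    ≤-trans (+-monoʳ-≤ ∣ toℕ i - row t ∣ (∣-∣-step (col t) j~j′)) (≤-reflexive (+-suc _ _))
  dist-step {_ , j} t (inj₂ (i~i′ , refl)) = +-monoˡ-≤ ∣ toℕ j - col t ∣ (∣-∣-step (row t) i~i′)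

  dist≤len : ∀ {u v} (p : Walk u v) → dist u v ≤ len p
  dist≤len {u} [] = ≤-reflexive (manhattan-self (coords u))
  dist≤len {v = v} (e ∷ p) = ≤-trans (dist-step v e) (s≤s (dist≤len p))

  shortest⇒len≤dist : ∀ {u v} {p : Walk u v} → IsShortest p → len p ≤ dist u v
  shortest⇒len≤dist {u} {v} shortest = ≤-trans (shortest (geodesic u v)) (≤-reflexive (len-geodesic u v))

  ∈w⇒dist≤len : ∀ {x s t} (p : Walk s t) → x ∈w p → dist s x + dist x t ≤ len p
  ∈w⇒dist≤len {x} {t = t} p here =
    subst (λ d → d + dist x t ≤ len p) (sym (manhattan-self (coords x))) (dist≤len p)
  ∈w⇒dist≤len {x} {t = t} (e ∷ p) (there x∈p) =
    ≤-trans (+-monoˡ-≤ (dist x t) (dist-step x e)) (s≤s (∈w⇒dist≤len p x∈p))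

  -- p is at least as long as the route s → x → y → t (on a shortest walk: x comes no later than y)
  Precedes : ∀ {s t} → Walk s t → V → V → Set
  Precedes {s} {t} p x y = dist s x + dist x y + dist y t ≤ len p

  ∈w-order : ∀ {x y s t} (p : Walk s t) → x ∈w p → y ∈w p → Precedes p x y ⊎ Precedes p y x
  ∈w-order {x} {y} {t = t} p here y∈p = inj₁
    (subst (λ d → d + dist x y + dist y t ≤ len p) (sym (manhattan-self (coords x))) (∈w⇒dist≤len p y∈p))
  ∈w-order {x} {y} {t = t} p (there x∈p) here = inj₂
    (subst (λ d → d + dist y x + dist x t ≤ len p) (sym (manhattan-self (coords y))) (∈w⇒dist≤len p (there x∈p)))
  ∈w-order {x} {y} {t = t} (e ∷ p) (there x∈p) (there y∈p) =
    Sum.map (extend x y) (extend y x) (∈w-order p x∈p y∈p)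
    where
    extend : ∀ x y → Precedes p x y → Precedes (e ∷ p) x y
    extend x y h = ≤-trans (+-monoˡ-≤ (dist y t) (+-monoˡ-≤ (dist x y) (dist-step x e))) (s≤s h)

  shortest-ordered⇒Between : ∀ {x y z s t} {p : Walk s t} → IsShortest p →
                             Precedes p x y → Precedes p y z → Between x y z
  shortest-ordered⇒Between {x} {y} {z} {s} {t} {p} shortest xy yz =
    manhattan-additive⇒Between₂ (coords x) (coords y) (coords z) (+-cancelˡ-≤ (dist s x) _ _ (begin
      dist s x + (dist x y + dist y z)  ≡⟨ +-assoc (dist s x) (dist x y) (dist y z) ⟨
      dist s x + dist x y + dist y z    ≤⟨ +-monoˡ-≤ (dist y z) s-x-y ⟩
      dist s y + dist y z               ≤⟨ s-y-z ⟩
      dist s x + dist x z               ∎))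
    where
    open ≤-Reasoning
    triangle : ∀ u v w → dist u w ≤ dist u v + dist v w
    triangle u v w = manhattan-triangle (coords u) (coords v) (coords w)
    s-x-y : dist s x + dist x y ≤ dist s y
    s-x-y = +-cancelʳ-≤ (dist y t) _ _ (begin
      dist s x + dist x y + dist y t  ≤⟨ xy ⟩
      len p                           ≤⟨ shortest⇒len≤dist shortest ⟩
      dist s t                        ≤⟨ triangle s y t ⟩
      dist s y + dist y t             ∎)
    s-y-z : dist s y + dist y z ≤ dist s x + dist x z
    s-y-z = +-cancelʳ-≤ (dist z t) _ _ (begin
      dist s y + dist y z + dist z t  ≤⟨ yz ⟩
      len p                           ≤⟨ shortest⇒len≤dist shortest ⟩
      dist s t                        ≤⟨ triangle s z t ⟩
      dist s z + dist z t             ≤⟨ +-monoˡ-≤ (dist z t) (triangle s x z) ⟩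
      dist s x + dist x z + dist z t  ∎)

  shortest-collinear : ∀ {x y z s t} {p : Walk s t} → IsShortest p →
                       x ∈w p → y ∈w p → z ∈w p → Collinear x y z
  shortest-collinear {x} {y} {z} {p = p} shortest x∈p y∈p z∈p =
    arrange (∈w-order p x∈p y∈p) (∈w-order p y∈p z∈p) (∈w-order p x∈p z∈p)
    where
    chain : ∀ {u v w} → Precedes p u v → Precedes p v w → Between u v w
    chain = shortest-ordered⇒Between shortest
    arrange : Precedes p x y ⊎ Precedes p y x → Precedes p y z ⊎ Precedes p z y →
              Precedes p x z ⊎ Precedes p z x → Collinear x y z
    arrange (inj₁ xy) (inj₁ yz) _         = inj₂ (inj₁ (chain xy yz))
    arrange (inj₁ xy) (inj₂ zy) (inj₁ xz) = inj₂ (inj₂ (chain xz zy))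
    arrange (inj₁ xy) (inj₂ zy) (inj₂ zx) = inj₁ (Between₂-sym (chain zx xy))
    arrange (inj₂ yx) (inj₁ yz) (inj₁ xz) = inj₁ (chain yx xz)
    arrange (inj₂ yx) (inj₁ yz) (inj₂ zx) = inj₂ (inj₂ (Between₂-sym (chain yz zx)))
    arrange (inj₂ yx) (inj₂ zy) _         = inj₂ (inj₁ (Between₂-sym (chain zy yx)))

  Between⇒geodesic : ∀ {x y z} → Between x y z → Σ[ p ∈ Walk x z ] IsShortest p × y ∈w p
  Between⇒geodesic {x} {y} {z} xyz = p ++ʷ q , shortest , ∈w-++ʷʳ p here
    where
    open ≤-Reasoning
    p = geodesic x y
    q = geodesic y z
    shortest : IsShortest (p ++ʷ q)
    shortest r = begin
      len (p ++ʷ q)        ≡⟨ len-++ʷ p q ⟩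
      len p + len q        ≡⟨ cong₂ _+_ (len-geodesic x y) (len-geodesic y z) ⟩
      dist x y + dist y z  ≡⟨ Between₂⇒manhattan-additive xyz ⟩
      dist x z             ≤⟨ dist≤len r ⟩
      len r                ∎

  GeneralPosition⇒¬Between : ∀ {S} → GeneralPosition S → ∀ {x y z} → x ∈ S → y ∈ S → z ∈ S →
                             x ≢ y → y ≢ z → x ≢ z → ¬ Between x y z
  GeneralPosition⇒¬Between gp x∈ y∈ z∈ x≢y y≢z x≢z xyz =
    let p , shortest , y∈p = Between⇒geodesic xyz
    in gp x∈ y∈ z∈ x≢y y≢z x≢z p shortest here y∈p (end-∈w p)

  GeneralPosition⇒¬Collinear : ∀ {S} → GeneralPosition S → ∀ {x y z} → x ∈ S → y ∈ S → z ∈ S →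
                               x ≢ y → y ≢ z → x ≢ z → ¬ Collinear x y z
  GeneralPosition⇒¬Collinear gp x∈ y∈ z∈ x≢y y≢z x≢z (inj₁ yxz) =
    GeneralPosition⇒¬Between gp y∈ x∈ z∈ (≢-sym x≢y) x≢z y≢z yxz
  GeneralPosition⇒¬Collinear gp x∈ y∈ z∈ x≢y y≢z x≢z (inj₂ (inj₁ xyz)) =
    GeneralPosition⇒¬Between gp x∈ y∈ z∈ x≢y y≢z x≢z xyz
  GeneralPosition⇒¬Collinear gp x∈ y∈ z∈ x≢y y≢z x≢z (inj₂ (inj₂ xzy)) =
    GeneralPosition⇒¬Between gp x∈ z∈ y∈ x≢z (≢-sym y≢z) x≢y xzy

  Collinear-in-triple : ∀ {p q r x y z} → let T = p ∷ q ∷ r ∷ [] in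
    x ∈ T → y ∈ T → z ∈ T → x ≢ y → y ≢ z → x ≢ z → Collinear x y z → Collinear p q r
  Collinear-in-triple (here refl) (there (here refl)) (there (there (here refl))) _ _ _ = id
  Collinear-in-triple (here refl) (there (there (here refl))) (there (here refl)) _ _ _ = Collinear₂-swap₂₃
  Collinear-in-triple (there (here refl)) (here refl) (there (there (here refl))) _ _ _ = Collinear₂-swap₁₂
  Collinear-in-triple (there (here refl)) (there (there (here refl))) (here refl) _ _ _ =
    Collinear₂-swap₁₂ ∘ Collinear₂-swap₂₃
  Collinear-in-triple (there (there (here refl))) (here refl) (there (here refl)) _ _ _ =
    Collinear₂-swap₂₃ ∘ Collinear₂-swap₁₂
  Collinear-in-triple (there (there (here refl))) (there (here refl)) (here refl) _ _ _ =
    Collinear₂-swap₁₂ ∘ Collinear₂-swap₂₃ ∘ Collinear₂-swap₁₂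
  Collinear-in-triple (here refl) (here refl) _ x≢y _ _ = ⊥-elim (x≢y refl)
  Collinear-in-triple (there (here refl)) (there (here refl)) _ x≢y _ _ = ⊥-elim (x≢y refl)
  Collinear-in-triple (there (there (here refl))) (there (there (here refl))) _ x≢y _ _ = ⊥-elim (x≢y refl)
  Collinear-in-triple _ (here refl) (here refl) _ y≢z _ = ⊥-elim (y≢z refl)
  Collinear-in-triple _ (there (here refl)) (there (here refl)) _ y≢z _ = ⊥-elim (y≢z refl)
  Collinear-in-triple _ (there (there (here refl))) (there (there (here refl))) _ y≢z _ = ⊥-elim (y≢z refl)
  Collinear-in-triple (here refl) _ (here refl) _ _ x≢z = ⊥-elim (x≢z refl)
  Collinear-in-triple (there (here refl)) _ (there (here refl)) _ _ x≢z = ⊥-elim (x≢z refl)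
  Collinear-in-triple (there (there (here refl))) _ (there (there (here refl))) _ _ x≢z = ⊥-elim (x≢z refl)
  Collinear-in-triple (there (there (there ()))) _ _
  Collinear-in-triple _ (there (there (there ()))) _
  Collinear-in-triple _ _ (there (there (there ())))

  ¬Collinear⇒IsGPSet : ∀ {x y z} → ¬ Collinear x y z → IsGPSet (x ∷ y ∷ z ∷ [])
  ¬Collinear⇒IsGPSet {x} {y} {z} ¬xyz = (x≢y ∷ x≢z ∷ []) ∷ (y≢z ∷ []) ∷ [] ∷ [] , general
    where
    x≢y : x ≢ y
    x≢y refl = ¬xyz (inj₁ (Between₂-reflˡ (coords x) (coords z)))
    y≢z : y ≢ z
    y≢z refl = ¬xyz (inj₂ (inj₁ (Between₂-reflʳ (coords x) (coords y))))
    x≢z : x ≢ z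
    x≢z refl = ¬xyz (inj₁ (Between₂-reflʳ (coords y) (coords x)))
    general : GeneralPosition (x ∷ y ∷ z ∷ [])
    general a∈ b∈ c∈ a≢b b≢c a≢c p shortest a∈p b∈p c∈p =
      ¬xyz (Collinear-in-triple a∈ b∈ c∈ a≢b b≢c a≢c (shortest-collinear shortest a∈p b∈p c∈p))

module CornerBound (n m : ℕ) where
  open Grid (suc n) (suc m)

  corner : V
  corner = zero , zero

  _≼_ _↙_ : V → V → Set
  x ≼ y = row x ≤ row y × col x ≤ col y
  x ↙ y = row x ≤ row y × col y ≤ col x

  ≼-or-↙ : ∀ x y → x ≼ y ⊎ y ≼ x ⊎ x ↙ y ⊎ y ↙ x
  ≼-or-↙ x y with ≤-total (row x) (row y) | ≤-total (col x) (col y)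
  ... | inj₁ rx≤ry | inj₁ cx≤cy = inj₁ (rx≤ry , cx≤cy)
  ... | inj₂ ry≤rx | inj₂ cy≤cx = inj₂ (inj₁ (ry≤rx , cy≤cx))
  ... | inj₁ rx≤ry | inj₂ cy≤cx = inj₂ (inj₂ (inj₁ (rx≤ry , cy≤cx)))
  ... | inj₂ ry≤rx | inj₁ cx≤cy = inj₂ (inj₂ (inj₂ (ry≤rx , cx≤cy)))

  ≼⇒Between-corner : ∀ {x y} → x ≼ y → Between corner x y
  ≼⇒Between-corner (rx≤ry , cx≤cy) = inj₁ (z≤n , rx≤ry) , inj₁ (z≤n , cx≤cy)

  ↙-Between : ∀ {x y z} → x ↙ y → y ↙ z → Between x y z
  ↙-Between (rx≤ry , cy≤cx) (ry≤rz , cz≤cy) = inj₁ (rx≤ry , ry≤rz) , inj₂ (cz≤cy , cy≤cx)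

  ↙-collinear : ∀ {x y z} → x ↙ y ⊎ y ↙ x → y ↙ z ⊎ z ↙ y → x ↙ z ⊎ z ↙ x → Collinear x y z
  ↙-collinear (inj₁ x↙y) (inj₁ y↙z) _ = inj₂ (inj₁ (↙-Between x↙y y↙z))
  ↙-collinear (inj₁ x↙y) (inj₂ z↙y) (inj₁ x↙z) = inj₂ (inj₂ (↙-Between x↙z z↙y))
  ↙-collinear (inj₁ x↙y) (inj₂ z↙y) (inj₂ z↙x) = inj₁ (Between₂-sym (↙-Between z↙x x↙y))
  ↙-collinear (inj₂ y↙x) (inj₁ y↙z) (inj₁ x↙z) = inj₁ (↙-Between y↙x x↙z)
  ↙-collinear (inj₂ y↙x) (inj₁ y↙z) (inj₂ z↙x) = inj₂ (inj₂ (Between₂-sym (↙-Between y↙z z↙x)))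
  ↙-collinear (inj₂ y↙x) (inj₂ z↙y) _ = inj₂ (inj₁ (Between₂-sym (↙-Between z↙y y↙x)))

  corner-with-three : ∀ {S x y z} → GeneralPosition S → corner ∈ S → All (_∈ S) (x ∷ y ∷ z ∷ []) →
                      Unique (corner ∷ x ∷ y ∷ z ∷ []) → ⊥
  corner-with-three {S} gp c∈ (x∈ ∷ y∈ ∷ z∈ ∷ [])
    ((c≢x ∷ c≢y ∷ c≢z ∷ []) ∷ (x≢y ∷ x≢z ∷ []) ∷ (y≢z ∷ []) ∷ [] ∷ []) =
    ¬collinear x∈ y∈ z∈ x≢y y≢z x≢z
      (↙-collinear (↙-pair x∈ y∈ c≢x c≢y x≢y) (↙-pair y∈ z∈ c≢y c≢z y≢z) (↙-pair x∈ z∈ c≢x c≢z x≢z))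
    where
    ¬collinear = GeneralPosition⇒¬Collinear gp
    ↙-pair : ∀ {u v} → u ∈ S → v ∈ S → corner ≢ u → corner ≢ v → u ≢ v → u ↙ v ⊎ v ↙ u
    ↙-pair {u} {v} u∈ v∈ c≢u c≢v u≢v with ≼-or-↙ u v
    ... | inj₁ u≼v = ⊥-elim (¬collinear c∈ u∈ v∈ c≢u u≢v c≢v (inj₂ (inj₁ (≼⇒Between-corner u≼v))))
    ... | inj₂ (inj₁ v≼u) = ⊥-elim (¬collinear c∈ u∈ v∈ c≢u u≢v c≢v (inj₂ (inj₂ (≼⇒Between-corner v≼u))))
    ... | inj₂ (inj₂ u↙v⊎v↙u) = u↙v⊎v↙u

  corner-excluded : ∀ {S} → IsGPSet S → 4 ≤ length S → corner ∉ S
  corner-excluded (uniq , gp) 4≤∣S∣ c∈ with companions uniq 4≤∣S∣ c∈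
  ... | _ , _ , _ , distinct , members = corner-with-three gp c∈ members distinct

  corner-unvisited : ∀ {S} → IsGPSet S → 4 ≤ length S → (r : Run S) → ¬ Visits corner r
  corner-unvisited gpset 4≤∣S∣ r visited =
    let _ , (gpsetT , 4≤∣T∣) , c∈T = occupied-invariant Large preserved (gpset , 4≤∣S∣) r visited
    in corner-excluded gpsetT 4≤∣T∣ c∈T
    where
    Large : List V → Set
    Large T = IsGPSet T × 4 ≤ length T
    preserved : ∀ {T U} → LegalMove T U → Large T → Large U
    preserved m ((uniq , _) , 4≤∣T∣) = move-IsGPSet m uniq , subst (4 ≤_) (move-length m) 4≤∣T∣

  mobile⇒length≤3 : ∀ {S} → Mobile S → length S ≤ 3
  mobile⇒length≤3 {S} (uniq , gp , run , visits-all) with length S ≤? 3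
  ... | yes ∣S∣≤3 = ∣S∣≤3
  ... | no ∣S∣≰3 = ⊥-elim (corner-unvisited (uniq , gp) (≰⇒> ∣S∣≰3) run (visits-all corner))

clamp : (K : ℕ) → ℕ → Fin (suc K)
clamp K zero = zero
clamp zero (suc k) = zero
clamp (suc K) (suc k) = suc (clamp K k)

toℕ-clamp : ∀ {K k} → k ≤ K → toℕ (clamp K k) ≡ k
toℕ-clamp {K} {zero} _ = refl
toℕ-clamp {suc K} {suc k} (s≤s k≤K) = cong suc (toℕ-clamp k≤K)

clamp-toℕ : ∀ {K} (x : Fin (suc K)) → clamp K (toℕ x) ≡ x
clamp-toℕ zero = refl
clamp-toℕ {suc K} (suc x) = cong suc (clamp-toℕ x)

data Position (K : ℕ) : ℕ → Set where
  first : Position K 0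
  inner : ∀ {k} → k ≤ K → Position K (suc k)
  last : Position K (suc (suc K))

position : ∀ {K i} → i ≤ suc (suc K) → Position K i
position {i = zero} _ = first
position {i = suc k} (s≤s k≤1+K) with m≤n⇒m<n∨m≡n k≤1+K
... | inj₁ (s≤s k≤K) = inner k≤K
... | inj₂ refl = last

module Construction (a b : ℕ) where
  N M : ℕ
  N = 2 + a
  M = 2 + b

  open Grid (suc N) (suc M)
  open Lanes Adj-sym Adj-irrefl

  ⟨_⟩ : ℕ × ℕ → V
  ⟨ i , j ⟩ = clamp N i , clamp M j

  InGrid : ℕ × ℕ → Set
  InGrid (i , j) = i ≤ N × j ≤ M

  coords-⟨⟩ : ∀ {p} → InGrid p → coords ⟨ p ⟩ ≡ p
  coords-⟨⟩ (i≤N , j≤M) = cong₂ _,_ (toℕ-clamp i≤N) (toℕ-clamp j≤M)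

  ⟨⟩-IsGPSet : ∀ {p q r} → InGrid p → InGrid q → InGrid r → ¬ Collinear₂ p q r →
               IsGPSet (⟨ p ⟩ ∷ ⟨ q ⟩ ∷ ⟨ r ⟩ ∷ [])
  ⟨⟩-IsGPSet p∈ q∈ r∈ ¬pqr =
    ¬Collinear⇒IsGPSet (¬pqr ∘ transport (coords-⟨⟩ p∈) (coords-⟨⟩ q∈) (coords-⟨⟩ r∈))
    where
    transport : ∀ {p p′ q q′ r r′} → p ≡ p′ → q ≡ q′ → r ≡ r′ → Collinear₂ p q r → Collinear₂ p′ q′ r′
    transport refl refl refl = id

  adj-right : ∀ i j → j < M → GridAdj (suc N) (suc M) ⟨ i , j ⟩ ⟨ i , suc j ⟩
  adj-right _ _ j<M = inj₁ (refl , inj₁ (trans (cong suc (toℕ-clamp (<⇒≤ j<M))) (sym (toℕ-clamp j<M))))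

  adj-down : ∀ i j → i < N → GridAdj (suc N) (suc M) ⟨ i , j ⟩ ⟨ suc i , j ⟩
  adj-down _ _ i<N = inj₂ (inj₁ (trans (cong suc (toℕ-clamp (<⇒≤ i<N))) (sym (toℕ-clamp i<N))) , refl)

  1<M : 1 < M
  1<M = s<s z<s

  gp-top-corners : ∀ i j → 0 < i → i ≤ N → 0 < j → j < M →
                   IsGPSet (⟨ 0 , 0 ⟩ ∷ ⟨ 0 , M ⟩ ∷ ⟨ i , j ⟩ ∷ [])
  gp-top-corners _ _ 0<i i≤N 0<j j<M = ⟨⟩-IsGPSet (z≤n , z≤n) (z≤n , ≤-refl) (i≤N , <⇒≤ j<M)
    (¬Collinear₂-cols 0<j j<M (¬Between₁-above 0<i 0<i) ∘ Collinear₂-swap₂₃)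

  gp-right-side : ∀ j₁ i j₂ → j₁ < M → 0 < i → i < N → j₂ < M →
                  IsGPSet (⟨ 0 , j₁ ⟩ ∷ ⟨ i , M ⟩ ∷ ⟨ N , j₂ ⟩ ∷ [])
  gp-right-side _ _ _ j₁<M 0<i i<N j₂<M = ⟨⟩-IsGPSet (z≤n , <⇒≤ j₁<M) (<⇒≤ i<N , ≤-refl) (≤-refl , <⇒≤ j₂<M)
    (¬Collinear₂-rows 0<i i<N (¬Between₁-above j₁<M j₂<M))

  gp-bottom-corner : ∀ j i → 0 < j → j < M → 0 < i → i ≤ N →
                     IsGPSet (⟨ 0 , j ⟩ ∷ ⟨ N , M ⟩ ∷ ⟨ i , 0 ⟩ ∷ [])
  gp-bottom-corner _ _ 0<j j<M 0<i i≤N = ⟨⟩-IsGPSet (z≤n , <⇒≤ j<M) (≤-refl , ≤-refl) (i≤N , z≤n)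
    (¬Collinear₂-cols 0<j j<M (¬Between₁-below 0<i z<s) ∘ Collinear₂-swap₁₂ ∘ Collinear₂-swap₂₃)

  gp-right-corners : ∀ i → 0 < i → i < N → IsGPSet (⟨ 0 , M ⟩ ∷ ⟨ N , M ⟩ ∷ ⟨ i , 0 ⟩ ∷ [])
  gp-right-corners _ 0<i i<N = ⟨⟩-IsGPSet (z≤n , ≤-refl) (≤-refl , ≤-refl) (<⇒≤ i<N , z≤n)
    (¬Collinear₂-rows 0<i i<N (¬Between₁-below z<s z<s) ∘ Collinear₂-swap₂₃)

  top-corners : List V
  top-corners = ⟨ 0 , 0 ⟩ ∷ ⟨ 0 , M ⟩ ∷ []

  row-lane : ∀ i → 0 < i → i ≤ N → Lane top-corners [] (λ k → ⟨ i , suc k ⟩) b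
  row-lane i 0<i i≤N = record
    { adjacent = λ {k} k<b → adj-right i (suc k) (s≤s (m≤n⇒m≤1+n k<b))
    ; gpset = λ {k} k≤b → gp-top-corners i (suc k) 0<i i≤N z<s (s≤s (s≤s k≤b))
    }

  row-trip : ∀ i → 0 < i → i ≤ N → top-corners ++ ⟨ i , 1 ⟩ ∷ [] ↝ top-corners ++ ⟨ i , 1 ⟩ ∷ []
  row-trip i 0<i i≤N = slide lane ◅◅ slideBack lane
    where lane = row-lane i 0<i i≤N

  sweep : ∀ r → r ≤ suc a → top-corners ++ ⟨ 1 , 1 ⟩ ∷ [] ↝ top-corners ++ ⟨ suc r , 1 ⟩ ∷ []
  sweep zero _ = row-trip 1 z<s z<s
  sweep (suc r) 1+r≤1+a =
    sweep r (≤-trans (n≤1+n r) 1+r≤1+a) ◅◅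
    advance top-corners [] (adj-down (suc r) 1 (s≤s 1+r≤1+a))
      (gp-top-corners (2 + r) 1 z<s (s≤s 1+r≤1+a) z<s 1<M) ◅
    row-trip (2 + r) z<s (s≤s 1+r≤1+a)

  sweep-visits : ∀ r (r≤1+a : r ≤ suc a) {i k} → i ≤ r → k ≤ b →
                 Visits ⟨ suc i , suc k ⟩ (toRun (sweep r r≤1+a))
  sweep-visits zero _ z≤n k≤b = visits-◅◅ˡ (slide lane) (slide-visits lane k≤b)
    where lane = row-lane 1 z<s z<s
  sweep-visits (suc r) 1+r≤1+a {i} {k} i≤1+r k≤b with m≤n⇒m<n∨m≡n i≤1+r
  ... | inj₁ (s≤s i≤r) = visits-◅◅ˡ (sweep r _) (sweep-visits r _ i≤r k≤b)
  ... | inj₂ refl = visits-◅◅ʳ (sweep r _) (inj₂ (visits-◅◅ˡ (slide lane) (slide-visits lane k≤b)))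
    where lane = row-lane (2 + r) z<s (s≤s 1+r≤1+a)

  right-lane : Lane (⟨ 0 , 0 ⟩ ∷ []) (⟨ N , 0 ⟩ ∷ []) (λ k → ⟨ suc k , M ⟩) a
  right-lane = record
    { adjacent = λ {k} k<a → adj-down (suc k) M (s≤s (s≤s (<⇒≤ k<a)))
    ; gpset = λ {k} k≤a → gp-right-side 0 (suc k) 0 z<s z<s (s≤s (s≤s k≤a)) z<s
    }

  down-right : top-corners ++ ⟨ N , 1 ⟩ ∷ [] ↝ ⟨ 0 , 0 ⟩ ∷ ⟨ suc a , M ⟩ ∷ ⟨ N , 0 ⟩ ∷ []
  down-right =
    advance (⟨ 0 , 0 ⟩ ∷ []) (⟨ N , 1 ⟩ ∷ []) (adj-down 0 M z<s)
      (gp-right-side 0 1 1 z<s z<s (s≤s z<s) 1<M) ◅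
    advance (⟨ 0 , 0 ⟩ ∷ ⟨ 1 , M ⟩ ∷ []) [] (Adj-sym (adj-right N 0 z<s)) (Lane.gpset right-lane z≤n) ◅
    slide right-lane

  top-lane : Lane [] (⟨ N , M ⟩ ∷ ⟨ N , 0 ⟩ ∷ []) (λ k → ⟨ 0 , suc k ⟩) b
  top-lane = record
    { adjacent = λ {k} k<b → adj-right 0 (suc k) (s≤s (m≤n⇒m≤1+n k<b))
    ; gpset = λ {k} k≤b → gp-bottom-corner (suc k) N z<s (s≤s (s≤s k≤b)) z<s ≤-refl
    }

  along-top : ⟨ 0 , 0 ⟩ ∷ ⟨ suc a , M ⟩ ∷ ⟨ N , 0 ⟩ ∷ [] ↝ ⟨ 0 , suc b ⟩ ∷ ⟨ N , M ⟩ ∷ ⟨ N , 0 ⟩ ∷ []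
  along-top =
    advance [] (⟨ suc a , M ⟩ ∷ ⟨ N , 0 ⟩ ∷ []) (adj-right 0 0 z<s)
      (gp-right-side 1 (suc a) 0 1<M z<s ≤-refl z<s) ◅
    advance (⟨ 0 , 1 ⟩ ∷ []) (⟨ N , 0 ⟩ ∷ []) (adj-down (suc a) M ≤-refl) (Lane.gpset top-lane z≤n) ◅
    slide top-lane

  left-lane : Lane (⟨ 0 , M ⟩ ∷ ⟨ N , M ⟩ ∷ []) [] (λ k → ⟨ suc k , 0 ⟩) a
  left-lane = record
    { adjacent = λ {k} k<a → adj-down (suc k) 0 (s≤s (s≤s (<⇒≤ k<a)))
    ; gpset = λ {k} k≤a → gp-right-corners (suc k) z<s (s≤s (s≤s k≤a))
    }

  up-left : ⟨ 0 , suc b ⟩ ∷ ⟨ N , M ⟩ ∷ ⟨ N , 0 ⟩ ∷ [] ↝ ⟨ 0 , M ⟩ ∷ ⟨ N , M ⟩ ∷ ⟨ 1 , 0 ⟩ ∷ []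
  up-left =
    advance (⟨ 0 , suc b ⟩ ∷ ⟨ N , M ⟩ ∷ []) [] (Adj-sym (adj-down (suc a) 0 ≤-refl))
      (gp-bottom-corner (suc b) (suc a) z<s ≤-refl z<s (n≤1+n _)) ◅
    advance [] (⟨ N , M ⟩ ∷ ⟨ suc a , 0 ⟩ ∷ []) (adj-right 0 (suc b) ≤-refl) (Lane.gpset left-lane ≤-refl) ◅
    slideBack left-lane

  start : List V
  start = top-corners ++ ⟨ 1 , 1 ⟩ ∷ []

  full-sweep : start ↝ top-corners ++ ⟨ N , 1 ⟩ ∷ []
  full-sweep = sweep (suc a) ≤-refl

  tour : start ↝ ⟨ 0 , M ⟩ ∷ ⟨ N , M ⟩ ∷ ⟨ 1 , 0 ⟩ ∷ []
  tour = full-sweep ◅◅ down-right ◅◅ along-top ◅◅ up-left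

  in-down-right : ∀ {x} → Visits x (toRun down-right) → Visits x (toRun tour)
  in-down-right visited = visits-◅◅ʳ full-sweep (visits-◅◅ˡ down-right visited)

  in-along-top : ∀ {x} → Visits x (toRun along-top) → Visits x (toRun tour)
  in-along-top visited = visits-◅◅ʳ full-sweep (visits-◅◅ʳ down-right (visits-◅◅ˡ along-top visited))

  in-up-left : ∀ {x} → Visits x (toRun up-left) → Visits x (toRun tour)
  in-up-left visited = visits-◅◅ʳ full-sweep (visits-◅◅ʳ down-right (visits-◅◅ʳ along-top visited))

  tour-visits-⟨⟩ : ∀ {i j} → i ≤ N → j ≤ M → Visits ⟨ i , j ⟩ (toRun tour)
  tour-visits-⟨⟩ i≤N j≤M with position i≤N | position j≤M
  ... | first | first = visits-start tour (here refl)
  ... | first | last = visits-start tour (there (here refl))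
  ... | inner i≤a | inner k≤b = visits-◅◅ˡ full-sweep (sweep-visits (suc a) ≤-refl (m≤n⇒m≤1+n i≤a) k≤b)
  ... | last | inner k≤b = visits-◅◅ˡ full-sweep (sweep-visits (suc a) ≤-refl ≤-refl k≤b)
  ... | inner k≤a | last = in-down-right (inj₂ (inj₂ (slide-visits right-lane k≤a)))
  ... | last | first = in-down-right (inj₂ (inj₂ (visits-start (slide right-lane) (there (there (here refl))))))
  ... | first | inner k≤b = in-along-top (inj₂ (inj₂ (slide-visits top-lane k≤b)))
  ... | last | last = in-along-top (inj₂ (inj₂ (visits-start (slide top-lane) (there (here refl)))))
  ... | inner k≤a | first = in-up-left (inj₂ (inj₂ (slideBack-visits left-lane k≤a)))

  start-mobile : Mobile start
  start-mobile = proj₁ start-gpset , proj₂ start-gpset , toRun tour , visits-all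
    where
    start-gpset = gp-top-corners 1 1 z<s z<s z<s 1<M
    visits-all : ∀ x → Visits x (toRun tour)
    visits-all (i , j) = subst (λ x → Visits x (toRun tour)) (cong₂ _,_ (clamp-toℕ i) (clamp-toℕ j))
                               (tour-visits-⟨⟩ (toℕ≤pred[n] i) (toℕ≤pred[n] j))

theorem3p2 : (n m : ℕ) → 3 ≤ n → 3 ≤ m → mob-grid-is n m 3
theorem3p2 (suc (suc (suc a))) (suc (suc (suc b))) (s≤s (s≤s (s≤s _))) (s≤s (s≤s (s≤s _))) =
  (start , start-mobile , refl) , λ _ → mobile⇒length≤3
  where
  open Construction a b using (start; start-mobile)
  open CornerBound (2 + a) (2 + b) using (mobile⇒length≤3)
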